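{- Let $L$ be a complete lattice and consider the quantale $(\mathrm{Hom}_{\vee}(L,L),\circ)$. For all $x,y\in L$ and $f \in\mathrm{Hom}_{\vee}(L,L)$: $$f/(c_y\circ a_x) = f^{\wedge}(x)\,\overline{\otimes}\,y,\qquad (c_y\circ a_x)\backslash f = x\,\overline{\otimes}\,f^{*}(y),$$ $$f/(y\,\overline{\otimes}\,x) = \big(f^{\wedge}(x)\,\overline{\otimes}\,\top\big)\wedge\big(f^{\wedge}(\bot)\,\overline{\otimes}\,y\big),\qquad (y\,\overline{\otimes}\,x)\backslash f = \big(\bot\,\overline{\otimes}\,f^{*}(y)\big)\wedge\big(x\,\overline{\otimes}\,f^{*}(\top)\big).$$
   Context: $\mathrm{Hom}_{\vee}(L,L)$ is the complete lattice of join-preserving maps $L\to L$, ordered pointwise, a quantale under composition. Divisions: $g\circ h \le k \iff h \le g\backslash k \iff g \le k/h$. For $x,y\in L$: $c_y(t)=y$ for $t\neq\bot$, $c_y(\bot)=\bot$; $a_x(t)=\top$ if $t\not\leq x$, $\bot$ if $t\le x$; $(y\,\overline{\otimes}\,x)(t)=\top$ if $t\not\leq x$, $=y$ if $\bot<t\leq x$, $=\bot$ if $t=\bot$. For $f\in\mathrm{Hom}_{\vee}(L,L)$, $f^{\wedge}(x) := \bigwedge_{t\not\leq x} f(t)$ (a meet-preserving map) and $f^{*}$ is the left adjoint of $f^{\wedge}$. -}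

module Defs where

open import Level using (Level; suc; _⊔_)
open import Data.Product using (Σ; ∃; _×_; _,_)
open import Data.Sum using (_⊎_)
open import Relation.Nullary using (¬_; yes; no)
open import Relation.Binary.PropositionalEquality using (_≡_)
open import Relation.Binary.Structures using (IsPartialOrder)
open import Axiom.ExcludedMiddle using (ExcludedMiddle)
open import Function.Bundles using (_⇔_)

record CompleteLattice (ℓ : Level) : Set (suc ℓ) where
  field
    Carrier        : Set ℓ
    _≤_            : Carrier → Carrier → Set ℓ
    isPartialOrder : IsPartialOrder _≡_ _≤_
    ⋁              : (Carrier → Set ℓ) → Carrier
    ⋁-upper        : ∀ (S : Carrier → Set ℓ) {s} → S s → s ≤ ⋁ S
    ⋁-least        : ∀ (S : Carrier → Set ℓ) {z} → (∀ {s} → S s → s ≤ z) → ⋁ S ≤ z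
    ⋀              : (Carrier → Set ℓ) → Carrier
    ⋀-lower        : ∀ (S : Carrier → Set ℓ) {s} → S s → ⋀ S ≤ s
    ⋀-greatest     : ∀ (S : Carrier → Set ℓ) {z} → (∀ {s} → S s → z ≤ s) → z ≤ ⋀ S

  ⊥ : Carrier
  ⊥ = ⋁ (λ _ → Lift′)
    where
    data Lift′ : Set ℓ where

  ⊤ : Carrier
  ⊤ = ⋀ (λ _ → Empty′)
    where
    data Empty′ : Set ℓ where

  _∧_ : Carrier → Carrier → Carrier
  x ∧ y = ⋀ (λ z → (z ≡ x) ⊎ (z ≡ y))

module Ops {ℓ : Level} (EM : ExcludedMiddle ℓ) (L : CompleteLattice ℓ) where
  open CompleteLattice L

  Map : Set ℓ
  Map = Carrier → Carrier

  IsJoinPreserving : Map → Set (suc ℓ)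
  IsJoinPreserving f =
    ∀ (S : Carrier → Set ℓ) → f (⋁ S) ≡ ⋁ (λ z → Σ Carrier (λ s → S s × (z ≡ f s)))

  _≤̇_ : Map → Map → Set ℓ
  f ≤̇ g = ∀ t → f t ≤ g t

  _∘̇_ : Map → Map → Map
  (g ∘̇ h) t = g (h t)

  _∧̇_ : Map → Map → Map
  (f ∧̇ g) t = f t ∧ g t

  IsRightDiv : Map → Map → Map → Set (suc ℓ)
  IsRightDiv f g k = IsJoinPreserving k ×
    (∀ h → IsJoinPreserving h → ((h ∘̇ g) ≤̇ f) ⇔ (h ≤̇ k))

  IsLeftDiv : Map → Map → Map → Set (suc ℓ)
  IsLeftDiv g f k = IsJoinPreserving k ×
    (∀ h → IsJoinPreserving h → ((g ∘̇ h) ≤̇ f) ⇔ (h ≤̇ k))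

  c : Carrier → Map
  c y t with EM {t ≡ ⊥}
  ... | yes _ = ⊥
  ... | no  _ = y

  a : Carrier → Map
  a x t with EM {t ≤ x}
  ... | yes _ = ⊥
  ... | no  _ = ⊤

  _⊗̄_ : Carrier → Carrier → Map
  (y ⊗̄ x) t with EM {t ≤ x}
  ... | no  _ = ⊤
  ... | yes _ with EM {t ≡ ⊥}
  ...   | yes _ = ⊥
  ...   | no  _ = y

  _^∧ : Map → Carrier → Carrier
  (f ^∧) x = ⋀ (λ z → Σ Carrier (λ t → (¬ (t ≤ x)) × (z ≡ f t)))

  -- f^* = left adjoint of the meet-preserving map f^∧:
  -- f^*(y) = ⋀ { x | y ≤ f^∧(x) }
  _^* : Map → Carrier → Carrier
  (f ^*) y = ⋀ (λ x → y ≤ (f ^∧) x)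

{-# OPTIONS --safe #-}
-- For a join-preserving h, the map v ⊗̄ u is the largest join-preserving map
-- with h u ≤ v, and the meet of two such maps with comparable thresholds is
-- again join-preserving. So each residual is found by reducing the condition
-- h ∘ g ≤ f (resp. g ∘ h ≤ f) to one or two inequalities of the form h u ≤ v:
-- precomposing with g gives bounds by f^∧, and postcomposing gives conditions
-- on h (f^* w), where f^* w = ⋁ { t | w ≰ f t }.
module Submission where

open import Defs
open import Level using (Level; Lift; lift)
open import Axiom.ExcludedMiddle using (ExcludedMiddle)
open import Axiom.DoubleNegationElimination using (em⇒dne)
open import Data.Empty using () renaming (⊥ to Empty)
open import Data.Product using (_×_; Σ; _,_)
open import Data.Product.Function.NonDependent.Propositional using (_×-⇔_)
open import Data.Sum using (_⊎_; inj₁; inj₂)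
open import Function.Base using (_∘_; const)
open import Function.Bundles using (_⇔_; mk⇔; Equivalence)
import Function.Properties.Equivalence as ⇔
open import Relation.Nullary using (¬_; yes; no; contradiction)
open import Relation.Nullary.Decidable using (toSum)
open import Relation.Binary.PropositionalEquality using (_≡_; refl; sym; trans; cong; subst)
open import Relation.Binary.Structures using (IsPartialOrder)

module JoinEndomorphisms {ℓ : Level} (EM : ExcludedMiddle ℓ) (L : CompleteLattice ℓ) where
  open CompleteLattice L
  open Ops EM L
  open IsPartialOrder isPartialOrder
    using (antisym; reflexive; ≤-respˡ-≈; ≤-respʳ-≈)
    renaming (refl to ≤-refl; trans to ≤-trans)

  private variable
    s t u u₁ u₂ v v₁ v₂ w z : Carrier
    f g h : Map

  -- Case splits go through toSum: a with on EM {P} itself would also abstract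
  -- the hidden case splits of c, a and ⊗̄, breaking the value lemmas below.
  excludedMiddle : (P : Set ℓ) → P ⊎ ¬ P
  excludedMiddle P = toSum EM

  stable : {P : Set ℓ} → ¬ ¬ P → P
  stable = em⇒dne EM

  ⊥-least : ∀ z → ⊥ ≤ z
  ⊥-least z = ⋁-least _ (λ ())

  ⊤-greatest : ∀ z → z ≤ ⊤
  ⊤-greatest z = ⋀-greatest _ (λ ())

  ≤⊥⇒≡⊥ : t ≤ ⊥ → t ≡ ⊥
  ≤⊥⇒≡⊥ {t} t≤⊥ = antisym t≤⊥ (⊥-least t)

  ≰⇒≢⊥ : ¬ t ≤ u → ¬ t ≡ ⊥
  ≰⇒≢⊥ {u = u} t≰u refl = t≰u (⊥-least u)

  ≢⊥-upward : s ≤ t → ¬ s ≡ ⊥ → ¬ t ≡ ⊥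
  ≢⊥-upward s≤t s≢⊥ refl = s≢⊥ (≤⊥⇒≡⊥ s≤t)

  ∧-lowerˡ : (v₁ ∧ v₂) ≤ v₁
  ∧-lowerˡ = ⋀-lower _ (inj₁ refl)

  ∧-lowerʳ : (v₁ ∧ v₂) ≤ v₂
  ∧-lowerʳ = ⋀-lower _ (inj₂ refl)

  ∧-greatest : z ≤ v₁ → z ≤ v₂ → z ≤ (v₁ ∧ v₂)
  ∧-greatest z≤v₁ z≤v₂ = ⋀-greatest _ λ { (inj₁ refl) → z≤v₁ ; (inj₂ refl) → z≤v₂ }

  ∧-mono : v₁ ≤ u₁ → v₂ ≤ u₂ → (v₁ ∧ v₂) ≤ (u₁ ∧ u₂)
  ∧-mono v₁≤u₁ v₂≤u₂ = ∧-greatest (≤-trans ∧-lowerˡ v₁≤u₁) (≤-trans ∧-lowerʳ v₂≤u₂)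

  ≤̇-∧̇ : h ≤̇ (f ∧̇ g) ⇔ (h ≤̇ f × h ≤̇ g)
  ≤̇-∧̇ = mk⇔ (λ h≤ → (λ t → ≤-trans (h≤ t) ∧-lowerˡ) , (λ t → ≤-trans (h≤ t) ∧-lowerʳ))
             (λ (h≤f , h≤g) t → ∧-greatest (h≤f t) (h≤g t))

  ⋁-witness : ∀ S → ¬ ⋁ S ≤ z → Σ Carrier λ s → S s × ¬ s ≤ z
  ⋁-witness S ⋁S≰z = stable λ none →
    ⋁S≰z (⋁-least S λ {s} s∈S → stable λ s≰z → none (s , s∈S , s≰z))

  Monotone : Map → Set ℓ
  Monotone g = ∀ {s t} → s ≤ t → g s ≤ g t

  module _ (h-jp : IsJoinPreserving h) where
    jp-monotone : Monotone h
    jp-monotone {s} {t} s≤t =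
      ≤-respʳ-≈ (trans (sym (h-jp pair)) (cong h ⋁pair≡t)) (⋁-upper _ (s , inj₁ refl , refl))
      where
      pair : Carrier → Set ℓ
      pair z = (z ≡ s) ⊎ (z ≡ t)
      ⋁pair≡t : ⋁ pair ≡ t
      ⋁pair≡t = antisym (⋁-least pair λ { (inj₁ refl) → s≤t ; (inj₂ refl) → ≤-refl })
                        (⋁-upper pair (inj₂ refl))

    jp-⋁-≤ : ∀ S → h (⋁ S) ≤ z ⇔ (∀ s → S s → h s ≤ z)
    jp-⋁-≤ S = mk⇔
      (λ h⋁S≤z s s∈S → ≤-trans (jp-monotone (⋁-upper S s∈S)) h⋁S≤z)
      (λ bound → ≤-respˡ-≈ (sym (h-jp S)) (⋁-least _ λ { (s , s∈S , refl) → bound s s∈S }))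

    jp-⊥ : h ⊥ ≡ ⊥
    jp-⊥ = ≤⊥⇒≡⊥ (≤-trans (jp-monotone (⊥-least (⋁ nothing)))
                          (Equivalence.from (jp-⋁-≤ nothing) λ _ → λ { (lift ()) }))
      where
      nothing : Carrier → Set ℓ
      nothing _ = Lift ℓ Empty

  jp-intro : Monotone g → g ⊥ ≡ ⊥ →
             (∀ S → ¬ ⋁ S ≤ ⊥ → Σ Carrier λ s → S s × g (⋁ S) ≤ g s) →
             IsJoinPreserving g
  jp-intro {g} g-mono g⊥≡⊥ pick S = antisym ≤image image≤
    where
    image≤ : ⋁ (λ z → Σ Carrier λ s → S s × (z ≡ g s)) ≤ g (⋁ S)
    image≤ = ⋁-least _ λ { (s , s∈S , refl) → g-mono (⋁-upper S s∈S) }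
    ≤image : g (⋁ S) ≤ ⋁ (λ z → Σ Carrier λ s → S s × (z ≡ g s))
    ≤image with excludedMiddle (⋁ S ≤ ⊥)
    ... | inj₁ ⋁S≤⊥ = ≤-respˡ-≈ (sym (trans (cong g (≤⊥⇒≡⊥ ⋁S≤⊥)) g⊥≡⊥)) (⊥-least _)
    ... | inj₂ ⋁S≰⊥ = let (s , s∈S , g⋁S≤gs) = pick S ⋁S≰⊥
                      in ≤-trans g⋁S≤gs (⋁-upper _ (s , s∈S , refl))

  c∘a-≤ : t ≤ u → c v (a u t) ≡ ⊥
  c∘a-≤ {t} {u} t≤u with EM {t ≤ u}
  ... | no t≰u = contradiction t≤u t≰u
  ... | yes _ with EM {⊥ ≡ ⊥}
  ...   | yes _ = refl
  ...   | no ⊥≢⊥ = contradiction refl ⊥≢⊥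

  -- In the one-point lattice c v ⊤ is ⊥ rather than v, but there ⊥ = v.
  c∘a-≰ : ¬ t ≤ u → c v (a u t) ≡ v
  c∘a-≰ {t} {u} {v} t≰u with EM {t ≤ u}
  ... | yes t≤u = contradiction t≤u t≰u
  ... | no _ with EM {⊤ ≡ ⊥}
  ...   | yes ⊤≡⊥ = sym (≤⊥⇒≡⊥ (≤-respʳ-≈ ⊤≡⊥ (⊤-greatest v)))
  ...   | no _ = refl

  ⊗̄-≰ : ¬ t ≤ u → (v ⊗̄ u) t ≡ ⊤
  ⊗̄-≰ {t} {u} t≰u with EM {t ≤ u}
  ... | yes t≤u = contradiction t≤u t≰u
  ... | no _ = refl

  ⊗̄-⊥ : (v ⊗̄ u) ⊥ ≡ ⊥
  ⊗̄-⊥ {u = u} with EM {⊥ ≤ u}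
  ... | no ⊥≰u = contradiction (⊥-least u) ⊥≰u
  ... | yes _ with EM {⊥ ≡ ⊥}
  ...   | yes _ = refl
  ...   | no ⊥≢⊥ = contradiction refl ⊥≢⊥

  ⊗̄-≤ : t ≤ u → ¬ t ≡ ⊥ → (v ⊗̄ u) t ≡ v
  ⊗̄-≤ {t} {u} t≤u t≢⊥ with EM {t ≤ u}
  ... | no t≰u = contradiction t≤u t≰u
  ... | yes _ with EM {t ≡ ⊥}
  ...   | yes t≡⊥ = contradiction t≡⊥ t≢⊥
  ...   | no _ = refl

  ⊗̄-monotone : Monotone (v ⊗̄ u)
  ⊗̄-monotone {u = u} {s} {t} s≤t with excludedMiddle (t ≤ u) | excludedMiddle (s ≡ ⊥)
  ... | inj₂ t≰u | _        = ≤-respʳ-≈ (sym (⊗̄-≰ t≰u)) (⊤-greatest _)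
  ... | inj₁ _   | inj₁ refl = ≤-respˡ-≈ (sym ⊗̄-⊥) (⊥-least _)
  ... | inj₁ t≤u | inj₂ s≢⊥ =
    reflexive (trans (⊗̄-≤ (≤-trans s≤t t≤u) s≢⊥) (sym (⊗̄-≤ t≤u (≢⊥-upward s≤t s≢⊥))))

  ⊗̄-≤-at-representative : ¬ s ≡ ⊥ → s ≤ t → (s ≤ u → t ≤ u) → (v ⊗̄ u) t ≤ (v ⊗̄ u) s
  ⊗̄-≤-at-representative {s} {u = u} s≢⊥ s≤t sameSide with excludedMiddle (s ≤ u)
  ... | inj₂ s≰u = ≤-respʳ-≈ (sym (⊗̄-≰ s≰u)) (⊤-greatest _)
  ... | inj₁ s≤u =
    reflexive (trans (⊗̄-≤ (sameSide s≤u) (≢⊥-upward s≤t s≢⊥)) (sym (⊗̄-≤ s≤u s≢⊥)))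

  -- An element of S on the same side of u₁ and of u₂ as ⋁ S: away from ⊥ the
  -- maps v ⊗̄ uᵢ take the same value there as at ⋁ S.
  Representative : (Carrier → Set ℓ) → Carrier → Carrier → Set ℓ
  Representative S u₁ u₂ =
    Σ Carrier λ s → S s × ¬ s ≡ ⊥ × (s ≤ u₁ → ⋁ S ≤ u₁) × (s ≤ u₂ → ⋁ S ≤ u₂)

  representative : ∀ S → u₁ ≤ u₂ → ¬ ⋁ S ≤ ⊥ → Representative S u₁ u₂
  representative {u₁ = u₁} {u₂ = u₂} S u₁≤u₂ ⋁S≰⊥ with excludedMiddle (⋁ S ≤ u₁) | excludedMiddle (⋁ S ≤ u₂)
  ... | inj₁ ⋁S≤u₁ | _ =
    let (s , s∈S , s≰⊥) = ⋁-witness S ⋁S≰⊥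
    in s , s∈S , ≰⇒≢⊥ s≰⊥ , const ⋁S≤u₁ , const (≤-trans ⋁S≤u₁ u₁≤u₂)
  ... | inj₂ ⋁S≰u₁ | inj₁ ⋁S≤u₂ =
    let (s , s∈S , s≰u₁) = ⋁-witness S ⋁S≰u₁
    in s , s∈S , ≰⇒≢⊥ s≰u₁ , (λ s≤u₁ → contradiction s≤u₁ s≰u₁) , const ⋁S≤u₂
  ... | inj₂ _ | inj₂ ⋁S≰u₂ =
    let (s , s∈S , s≰u₂) = ⋁-witness S ⋁S≰u₂
    in s , s∈S , ≰⇒≢⊥ s≰u₂ , (λ s≤u₁ → contradiction (≤-trans s≤u₁ u₁≤u₂) s≰u₂)
                           , (λ s≤u₂ → contradiction s≤u₂ s≰u₂)

  ⊗̄-isJoinPreserving : IsJoinPreserving (v ⊗̄ u)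
  ⊗̄-isJoinPreserving {u = u} = jp-intro ⊗̄-monotone ⊗̄-⊥ λ S ⋁S≰⊥ →
    let (s , s∈S , s≢⊥ , sameSide , _) = representative S (≤-refl {u}) ⋁S≰⊥
    in s , s∈S , ⊗̄-≤-at-representative s≢⊥ (⋁-upper S s∈S) sameSide

  ∧̇-⊗̄-isJoinPreserving : (u₁ ≤ u₂) ⊎ (u₂ ≤ u₁) →
                          IsJoinPreserving ((v₁ ⊗̄ u₁) ∧̇ (v₂ ⊗̄ u₂))
  ∧̇-⊗̄-isJoinPreserving {u₁} {u₂} comparable =
    jp-intro (λ s≤t → ∧-mono (⊗̄-monotone s≤t) (⊗̄-monotone s≤t))
             (≤⊥⇒≡⊥ (≤-trans ∧-lowerˡ (reflexive ⊗̄-⊥)))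
             λ S ⋁S≰⊥ →
               let (s , s∈S , s≢⊥ , sameSide₁ , sameSide₂) = either S ⋁S≰⊥ comparable
               in s , s∈S , ∧-mono (⊗̄-≤-at-representative s≢⊥ (⋁-upper S s∈S) sameSide₁)
                                   (⊗̄-≤-at-representative s≢⊥ (⋁-upper S s∈S) sameSide₂)
    where
    either : ∀ S → ¬ ⋁ S ≤ ⊥ → (u₁ ≤ u₂) ⊎ (u₂ ≤ u₁) → Representative S u₁ u₂
    either S ⋁S≰⊥ (inj₁ u₁≤u₂) = representative S u₁≤u₂ ⋁S≰⊥
    either S ⋁S≰⊥ (inj₂ u₂≤u₁) =
      let (s , s∈S , s≢⊥ , sameSide₂ , sameSide₁) = representative S u₂≤u₁ ⋁S≰⊥
      in s , s∈S , s≢⊥ , sameSide₁ , sameSide₂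

  ⊗̄-universal : IsJoinPreserving h → h ≤̇ (v ⊗̄ u) ⇔ h u ≤ v
  ⊗̄-universal {h} {v} {u} h-jp = mk⇔ to from
    where
    to : h ≤̇ (v ⊗̄ u) → h u ≤ v
    to h≤ with excludedMiddle (u ≡ ⊥)
    ... | inj₁ u≡⊥ = ≤-respˡ-≈ (sym (trans (cong h u≡⊥) (jp-⊥ h-jp))) (⊥-least v)
    ... | inj₂ u≢⊥ = ≤-respʳ-≈ (⊗̄-≤ ≤-refl u≢⊥) (h≤ u)
    from : h u ≤ v → h ≤̇ (v ⊗̄ u)
    from hu≤v t with excludedMiddle (t ≤ u) | excludedMiddle (t ≡ ⊥)
    ... | inj₂ t≰u | _        = ≤-respʳ-≈ (sym (⊗̄-≰ t≰u)) (⊤-greatest _)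
    ... | inj₁ _   | inj₁ refl = reflexive (trans (jp-⊥ h-jp) (sym ⊗̄-⊥))
    ... | inj₁ t≤u | inj₂ t≢⊥ =
      ≤-respʳ-≈ (sym (⊗̄-≤ t≤u t≢⊥)) (≤-trans (jp-monotone h-jp t≤u) hu≤v)

  ∧̇-⊗̄-universal : IsJoinPreserving h →
                   h ≤̇ ((v₁ ⊗̄ u₁) ∧̇ (v₂ ⊗̄ u₂)) ⇔ (h u₁ ≤ v₁ × h u₂ ≤ v₂)
  ∧̇-⊗̄-universal h-jp = ⇔.trans ≤̇-∧̇ (⊗̄-universal h-jp ×-⇔ ⊗̄-universal h-jp)

  ≤-^∧ : z ≤ (f ^∧) u ⇔ (∀ t → ¬ t ≤ u → z ≤ f t)
  ≤-^∧ = mk⇔ (λ z≤ t t≰u → ≤-trans z≤ (⋀-lower _ (t , t≰u , refl)))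
             (λ bound → ⋀-greatest _ λ { (t , t≰u , refl) → bound t t≰u })

  ^*-≡-⋁ : (f ^*) w ≡ ⋁ (λ t → ¬ w ≤ f t)
  ^*-≡-⋁ {f} {w} = antisym (⋀-lower _ w≤f^∧⋁) ⋁≤f^*w
    where
    w≤f^∧⋁ : w ≤ (f ^∧) (⋁ (λ t → ¬ w ≤ f t))
    w≤f^∧⋁ = Equivalence.from ≤-^∧ λ t t≰⋁ → stable λ w≰ft → t≰⋁ (⋁-upper _ w≰ft)
    ⋁≤f^*w : ⋁ (λ t → ¬ w ≤ f t) ≤ (f ^*) w
    ⋁≤f^*w = ⋁-least _ λ {t} w≰ft → ⋀-greatest _ λ w≤f^∧z →
      stable λ t≰z → w≰ft (Equivalence.to ≤-^∧ w≤f^∧z t t≰z)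

  ^*-monotone : w ≤ z → (f ^*) w ≤ (f ^*) z
  ^*-monotone {w = w} {z = z} {f = f} w≤z =
    ≤-respˡ-≈ (sym ^*-≡-⋁) (≤-respʳ-≈ (sym ^*-≡-⋁)
      (⋁-least _ λ {t} w≰ft → ⋁-upper (λ t → ¬ z ≤ f t) λ z≤ft → w≰ft (≤-trans w≤z z≤ft)))

  jp-^*-≤ : IsJoinPreserving h → h ((f ^*) w) ≤ z ⇔ (∀ t → ¬ w ≤ f t → h t ≤ z)
  jp-^*-≤ {h} {z = z} h-jp =
    ⇔.trans (mk⇔ (subst (λ e → h e ≤ z) ^*-≡-⋁) (subst (λ e → h e ≤ z) (sym ^*-≡-⋁)))
            (jp-⋁-≤ h-jp _)

  precomp-c∘a : IsJoinPreserving h → (h ∘̇ (c v ∘̇ a u)) ≤̇ f ⇔ h v ≤ (f ^∧) u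
  precomp-c∘a {h} {v} {u} {f} h-jp = ⇔.trans (mk⇔ to from) (⇔.sym ≤-^∧)
    where
    to : (h ∘̇ (c v ∘̇ a u)) ≤̇ f → ∀ t → ¬ t ≤ u → h v ≤ f t
    to h∘c∘a≤f t t≰u = ≤-respˡ-≈ (cong h (c∘a-≰ t≰u)) (h∘c∘a≤f t)
    from : (∀ t → ¬ t ≤ u → h v ≤ f t) → (h ∘̇ (c v ∘̇ a u)) ≤̇ f
    from bound t with excludedMiddle (t ≤ u)
    ... | inj₁ t≤u = ≤-respˡ-≈ (sym (trans (cong h (c∘a-≤ t≤u)) (jp-⊥ h-jp))) (⊥-least (f t))
    ... | inj₂ t≰u = ≤-respˡ-≈ (sym (cong h (c∘a-≰ t≰u))) (bound t t≰u)

  postcomp-c∘a : IsJoinPreserving h → ((c v ∘̇ a u) ∘̇ h) ≤̇ f ⇔ h ((f ^*) v) ≤ u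
  postcomp-c∘a {h} {v} {u} {f} h-jp = ⇔.trans (mk⇔ to from) (⇔.sym (jp-^*-≤ h-jp))
    where
    to : ((c v ∘̇ a u) ∘̇ h) ≤̇ f → ∀ t → ¬ v ≤ f t → h t ≤ u
    to c∘a∘h≤f t v≰ft = stable λ ht≰u → v≰ft (≤-respˡ-≈ (c∘a-≰ ht≰u) (c∘a∘h≤f t))
    from : (∀ t → ¬ v ≤ f t → h t ≤ u) → ((c v ∘̇ a u) ∘̇ h) ≤̇ f
    from bound t with excludedMiddle (h t ≤ u)
    ... | inj₁ ht≤u = ≤-respˡ-≈ (sym (c∘a-≤ ht≤u)) (⊥-least (f t))
    ... | inj₂ ht≰u = ≤-respˡ-≈ (sym (c∘a-≰ ht≰u)) (stable λ v≰ft → ht≰u (bound t v≰ft))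

  precomp-⊗̄ : IsJoinPreserving h →
              (h ∘̇ (v ⊗̄ u)) ≤̇ f ⇔ (h ⊤ ≤ (f ^∧) u × h v ≤ (f ^∧) ⊥)
  precomp-⊗̄ {h} {v} {u} {f} h-jp = ⇔.trans (mk⇔ to from) (⇔.sym (≤-^∧ ×-⇔ ≤-^∧))
    where
    to : (h ∘̇ (v ⊗̄ u)) ≤̇ f →
         (∀ t → ¬ t ≤ u → h ⊤ ≤ f t) × (∀ t → ¬ t ≤ ⊥ → h v ≤ f t)
    to h∘⊗̄≤f = outside , inside
      where
      outside : ∀ t → ¬ t ≤ u → h ⊤ ≤ f t
      outside t t≰u = ≤-respˡ-≈ (cong h (⊗̄-≰ t≰u)) (h∘⊗̄≤f t)
      inside : ∀ t → ¬ t ≤ ⊥ → h v ≤ f t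
      inside t t≰⊥ with excludedMiddle (t ≤ u)
      ... | inj₁ t≤u = ≤-respˡ-≈ (cong h (⊗̄-≤ t≤u (≰⇒≢⊥ t≰⊥))) (h∘⊗̄≤f t)
      ... | inj₂ t≰u = ≤-trans (jp-monotone h-jp (⊤-greatest v)) (outside t t≰u)
    from : (∀ t → ¬ t ≤ u → h ⊤ ≤ f t) × (∀ t → ¬ t ≤ ⊥ → h v ≤ f t) →
           (h ∘̇ (v ⊗̄ u)) ≤̇ f
    from (outside , inside) t with excludedMiddle (t ≤ u) | excludedMiddle (t ≡ ⊥)
    ... | inj₂ t≰u | _        = ≤-respˡ-≈ (sym (cong h (⊗̄-≰ t≰u))) (outside t t≰u)
    ... | inj₁ _   | inj₁ refl = ≤-respˡ-≈ (sym (trans (cong h ⊗̄-⊥) (jp-⊥ h-jp))) (⊥-least _)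
    ... | inj₁ t≤u | inj₂ t≢⊥ =
      ≤-respˡ-≈ (sym (cong h (⊗̄-≤ t≤u t≢⊥))) (inside t (t≢⊥ ∘ ≤⊥⇒≡⊥))

  postcomp-⊗̄ : IsJoinPreserving h →
               ((v ⊗̄ u) ∘̇ h) ≤̇ f ⇔ (h ((f ^*) v) ≤ ⊥ × h ((f ^*) ⊤) ≤ u)
  postcomp-⊗̄ {h} {v} {u} {f} h-jp =
    ⇔.trans (mk⇔ to from) (⇔.sym (jp-^*-≤ h-jp ×-⇔ jp-^*-≤ h-jp))
    where
    to : ((v ⊗̄ u) ∘̇ h) ≤̇ f →
         (∀ t → ¬ v ≤ f t → h t ≤ ⊥) × (∀ t → ¬ ⊤ ≤ f t → h t ≤ u)
    to ⊗̄∘h≤f = belowBottom , belowU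
      where
      belowU : ∀ t → ¬ ⊤ ≤ f t → h t ≤ u
      belowU t ⊤≰ft = stable λ ht≰u → ⊤≰ft (≤-respˡ-≈ (⊗̄-≰ ht≰u) (⊗̄∘h≤f t))
      belowBottom : ∀ t → ¬ v ≤ f t → h t ≤ ⊥
      belowBottom t v≰ft = stable λ ht≰⊥ →
        let ht≤u = belowU t λ ⊤≤ft → v≰ft (≤-trans (⊤-greatest v) ⊤≤ft)
        in v≰ft (≤-respˡ-≈ (⊗̄-≤ ht≤u (≰⇒≢⊥ ht≰⊥)) (⊗̄∘h≤f t))
    from : (∀ t → ¬ v ≤ f t → h t ≤ ⊥) × (∀ t → ¬ ⊤ ≤ f t → h t ≤ u) →
           ((v ⊗̄ u) ∘̇ h) ≤̇ f
    from (belowBottom , belowU) t with excludedMiddle (h t ≤ u) | excludedMiddle (h t ≡ ⊥)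
    ... | inj₂ ht≰u | _ =
      ≤-respˡ-≈ (sym (⊗̄-≰ ht≰u)) (stable λ ⊤≰ft → ht≰u (belowU t ⊤≰ft))
    ... | inj₁ _ | inj₁ ht≡⊥ =
      ≤-respˡ-≈ (sym (trans (cong (v ⊗̄ u) ht≡⊥) ⊗̄-⊥)) (⊥-least _)
    ... | inj₁ ht≤u | inj₂ ht≢⊥ =
      ≤-respˡ-≈ (sym (⊗̄-≤ ht≤u ht≢⊥)) (stable λ v≰ft → ht≢⊥ (≤⊥⇒≡⊥ (belowBottom t v≰ft)))

mainTheorem8 : ∀ {ℓ : Level} (EM : ExcludedMiddle ℓ) (L : CompleteLattice ℓ) →
    let open CompleteLattice L
        open Ops EM L
    in ∀ (x y : Carrier) (f : Map) → IsJoinPreserving f →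
       IsRightDiv f (c y ∘̇ a x) ((f ^∧) x ⊗̄ y)
       × IsLeftDiv (c y ∘̇ a x) f (x ⊗̄ (f ^*) y)
       × IsRightDiv f (y ⊗̄ x) (((f ^∧) x ⊗̄ ⊤) ∧̇ ((f ^∧) ⊥ ⊗̄ y))
       × IsLeftDiv (y ⊗̄ x) f ((⊥ ⊗̄ (f ^*) y) ∧̇ (x ⊗̄ (f ^*) ⊤))
mainTheorem8 EM L x y f _ =
    (⊗̄-isJoinPreserving , λ h h-jp →
       ⇔.trans (precomp-c∘a h-jp) (⇔.sym (⊗̄-universal h-jp)))
  , (⊗̄-isJoinPreserving , λ h h-jp →
       ⇔.trans (postcomp-c∘a h-jp) (⇔.sym (⊗̄-universal h-jp)))
  , (∧̇-⊗̄-isJoinPreserving (inj₂ (⊤-greatest y)) , λ h h-jp →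
       ⇔.trans (precomp-⊗̄ h-jp) (⇔.sym (∧̇-⊗̄-universal h-jp)))
  , (∧̇-⊗̄-isJoinPreserving (inj₁ (^*-monotone (⊤-greatest y))) , λ h h-jp →
       ⇔.trans (postcomp-⊗̄ h-jp) (⇔.sym (∧̇-⊗̄-universal h-jp)))
  where open JoinEndomorphisms EM L
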